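{- Let $L$ be a finite lattice whose greatest element $1$ is join-reducible. The following statements are equivalent. (a) $L$ is a lower dismantlable lattice. (b) Every nonzero element of $L$ is meet-irreducible. (c) The cover graph $CG(L\setminus\{0\})$ of $L\setminus\{0\}$ is a tree. (d) The zero-divisor graph $G_{\{0\}}(L)$ coincides with the incomparability graph of $L\setminus\{0,1\}$.
   Context: Adjunct operation: for disjoint finite lattices $L_1,L_2$ and $a<b$ in $L_1$ with $b$ not covering $a$, $L_1]_a^bL_2$ is $L_1\cup L_2$ ordered by: $x\le y$ iff ($x,y\in L_1$, $x\le y$ in $L_1$) or ($x,y\in L_2$, $x\le y$ in $L_2$) or ($x\in L_1$, $y\in L_2$, $x\le a$) or ($x\in L_2$, $y\in L_1$, $b\le y$); $(a,b)$ is an adjunct pair. A finite lattice is dismantlable iff it is an adjunct of chains $C_0]_{a_1}^{b_1}C_1\cdots]_{a_n}^{b_n}C_n$; it is lower dismantlable if it is a chain or every adjunct pair is of the form $(0,b)$. An element $x$ is join-reducible (meet-reducible) if $x=y\vee z$ ($x=y\wedge z$) for some $y,z\ne x$, and meet-irreducible if not meet-reducible. The cover graph of a poset $P$ has vertex set $P$, with $x,y$ adjacent iff one covers the other. The incomparability graph of a poset has as edges the pairs of incomparable elements. The zero-divisor graph $G_{\{0\}}(L)$ has vertex set $\{x\in L\setminus\{0\}: x\wedge y=0\text{ for some }y\in L\setminus\{0\}\}$, distinct vertices $x,y$ adjacent iff $x\wedge y=0$. -}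

module Defs where

open import Level using (0ℓ)
open import Data.Nat using (ℕ; suc; _+_)
open import Data.Fin using (Fin; toℕ; splitAt)
open import Data.Fin.Base as F using ()
open import Data.Sum using (_⊎_; inj₁; inj₂)
open import Data.Product using (Σ; ∃; ∃-syntax; _×_; _,_)
open import Data.Unit using (⊤)
open import Data.List using (List; []; _∷_; _++_)
open import Data.List.Relation.Unary.Linked using (Linked)
open import Data.List.Relation.Unary.Unique.Propositional using (Unique)
open import Relation.Nullary using (¬_)
open import Relation.Binary using (Rel; Decidable; IsPartialOrder)
open import Relation.Binary.Lattice.Structures using (IsBoundedLattice)
open import Relation.Binary.PropositionalEquality using (_≡_; _≢_)
open import Relation.Binary.Construct.Closure.ReflexiveTransitive using (Star)
open import Function.Bundles using (_⤖_; _⇔_; Bijection)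

record FiniteLattice : Set₁ where
  field
    n     : ℕ
    _≤_   : Rel (Fin n) 0ℓ
    _≤?_  : Decidable _≤_
    _∨_   : Fin n → Fin n → Fin n
    _∧_   : Fin n → Fin n → Fin n
    𝟙     : Fin n
    𝟘     : Fin n
    isBoundedLattice : IsBoundedLattice _≡_ _≤_ _∨_ _∧_ 𝟙 𝟘

  _<_ : Rel (Fin n) 0ℓ
  x < y = x ≤ y × x ≢ y

  _∥_ : Rel (Fin n) 0ℓ
  x ∥ y = ¬ (x ≤ y) × ¬ (y ≤ x)

  IsChain : Set
  IsChain = ∀ x y → x ≤ y ⊎ y ≤ x

  JoinReducible : Fin n → Set
  JoinReducible x = ∃[ y ] ∃[ z ] (y ≢ x × z ≢ x × x ≡ y ∨ z)

  MeetReducible : Fin n → Set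
  MeetReducible x = ∃[ y ] ∃[ z ] (y ≢ x × z ≢ x × x ≡ y ∧ z)

  MeetIrreducible : Fin n → Set
  MeetIrreducible x = ¬ MeetReducible x

record Graph (n : ℕ) : Set₁ where
  field
    Vertex : Fin n → Set
    Edge   : Fin n → Fin n → Set

module _ {n : ℕ} (G : Graph n) where
  open Graph G

  Connected : Set
  Connected = ∀ x y → Vertex x → Vertex y → Star Edge x y

  HasCycle : Set
  HasCycle = ∃[ v0 ] ∃[ v1 ] ∃[ v2 ] Σ (List (Fin n)) λ rest →
    (∀ v → v ∈' (v0 ∷ v1 ∷ v2 ∷ rest) → Vertex v)
    × Unique (v0 ∷ v1 ∷ v2 ∷ rest)
    × Linked Edge ((v0 ∷ v1 ∷ v2 ∷ rest) ++ (v0 ∷ []))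
    where
      open import Data.List.Membership.Propositional renaming (_∈_ to _∈'_)

  IsTree : Set
  IsTree = Connected × ¬ HasCycle

_≅G_ : ∀ {n} → Graph n → Graph n → Set
G ≅G H = (∀ x → Vertex G x ⇔ Vertex H x) × (∀ x y → Edge G x y ⇔ Edge H x y)
  where open Graph

module _ (L : FiniteLattice) where
  open FiniteLattice L

  Covers₀ : Fin n → Fin n → Set
  Covers₀ x y = x ≢ 𝟘 × y ≢ 𝟘 × x < y ×
                ¬ (∃[ c ] (c ≢ 𝟘 × x < c × c < y))

  CoverGraph₀ : Graph n
  CoverGraph₀ = record
    { Vertex = λ x → x ≢ 𝟘
    ; Edge   = λ x y → Covers₀ x y ⊎ Covers₀ y x }

  ZeroDivisorGraph : Graph n
  ZeroDivisorGraph = record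
    { Vertex = λ x → x ≢ 𝟘 × ∃[ y ] (y ≢ 𝟘 × x ∧ y ≡ 𝟘)
    ; Edge   = λ x y → (x ≢ 𝟘 × ∃[ z ] (z ≢ 𝟘 × x ∧ z ≡ 𝟘))
                     × (y ≢ 𝟘 × ∃[ z ] (z ≢ 𝟘 × y ∧ z ≡ 𝟘))
                     × x ≢ y × x ∧ y ≡ 𝟘 }

  IncomparabilityGraph₀₁ : Graph n
  IncomparabilityGraph₀₁ = record
    { Vertex = λ x → x ≢ 𝟘 × x ≢ 𝟙
    ; Edge   = λ x y → (x ≢ 𝟘 × x ≢ 𝟙) × (y ≢ 𝟘 × y ≢ 𝟙) × x ∥ y }

-- Adjunct representations of chains:
--   C₀ ]_{a₁}^{b₁} C₁ ⋯ ]_{aₘ}^{bₘ} Cₘ   (left-associated)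
-- An expression of type Adj m has carrier Fin m.  Chains are nonempty:
-- 'chain k' is the chain 0 < 1 < ⋯ < k.  In 'adj D a b k' the old
-- elements are Fin m (first part of splitAt) and the new chain the second.

data Adj : ℕ → Set where
  chain : (k : ℕ) → Adj (suc k)
  adj   : ∀ {m} → Adj m → Fin m → Fin m → (k : ℕ) → Adj (m + suc k)

AdjLeq : ∀ {m} → Adj m → Fin m → Fin m → Set
AdjLeq (chain k) x y = x F.≤ y
AdjLeq (adj {m} D a b k) x y = go (splitAt m x) (splitAt m y)
  where
    go : Fin m ⊎ Fin (suc k) → Fin m ⊎ Fin (suc k) → Set
    go (inj₁ u) (inj₁ v) = AdjLeq D u v
    go (inj₂ u) (inj₂ v) = u F.≤ v
    go (inj₁ u) (inj₂ v) = AdjLeq D u a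
    go (inj₂ u) (inj₁ v) = AdjLeq D b v

AdjLt : ∀ {m} → Adj m → Fin m → Fin m → Set
AdjLt D x y = AdjLeq D x y × x ≢ y

AdjCovers : ∀ {m} → Adj m → Fin m → Fin m → Set
AdjCovers D a b = AdjLt D a b × ¬ (∃[ c ] (AdjLt D a c × AdjLt D c b))

-- well-formed adjunct representation in which every adjunct pair (a,b)
-- has a = 0 (the least element of the lattice built so far):
-- a < b, b does not cover a, a is the least element.
LowerWF : ∀ {m} → Adj m → Set
LowerWF (chain k) = ⊤
LowerWF (adj D a b k) =
  LowerWF D × AdjLt D a b × ¬ AdjCovers D a b × (∀ x → AdjLeq D a x)

module _ (L : FiniteLattice) where
  open FiniteLattice L

  IsoAdj : Adj n → Set
  IsoAdj D = Σ (Fin n ⤖ Fin n) λ f →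
    ∀ x y → (x ≤ y) ⇔ AdjLeq D (Bijection.to f x) (Bijection.to f y)

  LowerDismantlable : Set
  LowerDismantlable = IsChain ⊎ (∃[ D ] (LowerWF D × IsoAdj D))

module Submission where

-- All four conditions are equivalent to: (T) for every x ≠ 0 the filter ↑x is a chain.
-- (b) ⇔ (T): if x = y ∧ z with y, z ≠ x then y ∥ z, and conversely for y ∥ z above x ≠ 0 the meet y ∧ z ≠ 0
-- is meet-reducible.  (a) ⇒ (T): adjoining a chain along a pair (0, b) keeps filters of nonzero elements chains.
-- (T) ⇒ (a): start from 0 and the chain [l, 1] for an atom l; while some element is missing, climb from it
-- to a missing x whose cover p is present, and adjoin the chain [l′, x], l′ an atom below x, along (0, p).
-- (T) ⇒ (c): upper covers in L ∖ {0} are unique, so a closed non-backtracking walk can neither descend and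
-- then rise, nor rise at both ends.  (c) ⇒ (b): for x = y ∧ z ≠ 0 as above, covers u₁ ≤ y and u₂ ≤ z of x
-- are distinct, and saturated chains from them to u₁ ∨ u₂ close a cycle.
-- (T) ⇒ (d): nonzero elements meet in 0 iff they are incomparable, and if 1 = y₁ ∨ z₁ then every
-- x ∉ {0, 1} meets y₁ or z₁ in 0.  (d) ⇒ (b): x = y ∧ z with y ∥ z makes y, z adjacent, so x = 0.

open import Level using (0ℓ)
open import Data.Nat as ℕ using (ℕ; zero; suc; _+_; _∸_; z≤n; s≤s)
import Data.Nat.Properties as ℕ
import Data.Nat.Induction as ℕ
open import Data.Fin using (Fin; zero; suc; splitAt; join; _↑ˡ_; _↑ʳ_; _≟_)
import Data.Fin.Base as F
import Data.Fin.Properties as FinP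
open import Data.Fin.Induction using (po-wellFounded; po-noetherian)
open import Data.Sum using (_⊎_; inj₁; inj₂; [_,_]; [_,_]′)
import Data.Sum as Sum
open import Data.Product using (Σ; ∃; ∃-syntax; _×_; _,_; proj₁; proj₂; swap)
open import Data.Empty using (⊥; ⊥-elim)
open import Data.Unit using (⊤; tt)
open import Data.List using (List; []; _∷_; _++_)
open import Data.List.Properties using (++-assoc)
open import Data.List.Relation.Binary.Disjoint.Propositional using (Disjoint)
import Data.List.Relation.Unary.All.Properties as AllP
import Data.List.Relation.Unary.Unique.Propositional.Properties as UniqueP
open import Data.List.Membership.Propositional using (_∈_)
open import Data.List.Relation.Unary.Any using (here; there)
open import Data.List.Relation.Unary.All using (All; []; _∷_)
import Data.List.Relation.Unary.All as All
open import Data.List.Relation.Unary.AllPairs using ([]; _∷_)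
open import Data.List.Relation.Unary.Linked using (Linked; [-]; _∷_)
open import Data.List.Relation.Unary.Unique.Propositional using (Unique)
open import Function.Base using (_∘_; flip)
open import Function.Bundles using (_⇔_; mk⇔; mk↔ₛ′; Equivalence; Bijection)
open import Function.Properties.Inverse using (↔⇒⤖)
open import Induction.WellFounded using (WellFounded; Acc; acc)
open import Relation.Nullary using (¬_; Dec; yes; no)
open import Relation.Nullary.Decidable using (_×-dec_; ¬?; decidable-stable)
open import Relation.Binary using (Rel; Decidable)
open import Relation.Unary using () renaming (Decidable to Decidable₁)
open import Function.Definitions using (Injective)
open import Relation.Binary.Lattice.Bundles using (BoundedLattice)
open import Relation.Binary.Lattice.Structures using (IsBoundedLattice)
open import Relation.Binary.PropositionalEquality using (_≡_; _≢_; refl; sym; trans; cong; subst; subst₂)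
open import Relation.Binary.Construct.Closure.ReflexiveTransitive using (Star; ε; _◅_; _◅◅_)
import Relation.Binary.Construct.Closure.ReflexiveTransitive as Star

open import Defs

module LatticeProperties (L : FiniteLattice) where
  open FiniteLattice L public
  open IsBoundedLattice isBoundedLattice public
    using (isPartialOrder; antisym; x∧y≤x; x∧y≤y; ∧-greatest; x≤x∨y; y≤x∨y; ∨-least; maximum; minimum)
    renaming (refl to ≤-refl; trans to ≤-trans; reflexive to ≤-reflexive)

  private
    boundedLattice : BoundedLattice 0ℓ 0ℓ 0ℓ
    boundedLattice = record { isBoundedLattice = isBoundedLattice }
    open BoundedLattice boundedLattice using (joinSemilattice; meetSemilattice)

  open import Relation.Binary.Lattice.Properties.JoinSemilattice joinSemilattice public
    using (x≤y⇒x∨y≈y; ∨-comm)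
  open import Relation.Binary.Lattice.Properties.MeetSemilattice meetSemilattice public
    using (y≤x⇒x∧y≈y; ∧-comm; ∧-monotonic)
  open import Relation.Binary.Construct.NonStrictToStrict _≡_ _≤_ as Strict using ()

  variable
    x y z : Fin n

  x≤y⇒x∧y≈x : x ≤ y → x ∧ y ≡ x
  x≤y⇒x∧y≈x {x} {y} x≤y = trans (∧-comm x y) (y≤x⇒x∧y≈y x≤y)

  y≤x⇒x∨y≈x : y ≤ x → x ∨ y ≡ x
  y≤x⇒x∨y≈x {y} {x} y≤x = trans (∨-comm x y) (x≤y⇒x∨y≈y y≤x)

  ≤𝟘⇒≡𝟘 : x ≤ 𝟘 → x ≡ 𝟘
  ≤𝟘⇒≡𝟘 x≤𝟘 = antisym x≤𝟘 (minimum _)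

  ≢𝟘-mono : x ≢ 𝟘 → x ≤ y → y ≢ 𝟘
  ≢𝟘-mono x≢𝟘 x≤y y≡𝟘 = x≢𝟘 (≤𝟘⇒≡𝟘 (subst (_ ≤_) y≡𝟘 x≤y))

  ∥⇒≢𝟘 : x ∥ y → x ≢ 𝟘
  ∥⇒≢𝟘 (x≰y , _) refl = x≰y (minimum _)

  ∥⇒≢𝟙 : x ∥ y → x ≢ 𝟙
  ∥⇒≢𝟙 (_ , y≰x) refl = y≰x (maximum _)

  ∧-incomparable : x ≡ y ∧ z → y ≢ x → z ≢ x → y ∥ z
  ∧-incomparable x≡y∧z y≢x z≢x =
    (λ y≤z → y≢x (trans (sym (x≤y⇒x∧y≈x y≤z)) (sym x≡y∧z))) ,
    (λ z≤y → z≢x (trans (sym (y≤x⇒x∧y≈y z≤y)) (sym x≡y∧z)))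

  ∨-incomparable : x ≡ y ∨ z → y ≢ x → z ≢ x → y ∥ z
  ∨-incomparable x≡y∨z y≢x z≢x =
    (λ y≤z → z≢x (trans (sym (x≤y⇒x∨y≈y y≤z)) (sym x≡y∨z))) ,
    (λ z≤y → y≢x (trans (sym (y≤x⇒x∨y≈x z≤y)) (sym x≡y∨z)))

  <-trans : x < y → y < z → x < z
  <-trans = Strict.<-trans isPartialOrder

  <-≤-trans : x < y → y ≤ z → x < z
  <-≤-trans = Strict.<-≤-trans sym ≤-trans antisym λ { refl x≤y → x≤y }

  <-irrefl : ¬ x < x
  <-irrefl = Strict.<-irrefl refl

  <⇒≱ : x < y → ¬ y ≤ x
  <⇒≱ = Strict.<⇒≱ antisym

  _<?_ : Decidable _<_
  _<?_ = Strict.<-decidable _≟_ _≤?_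

  <-wellFounded : WellFounded _<_
  <-wellFounded = po-wellFounded isPartialOrder

  >-wellFounded : WellFounded (flip _<_)
  >-wellFounded = po-noetherian isPartialOrder

  infix 4 _⋖_
  _⋖_ : Rel (Fin n) 0ℓ
  x ⋖ y = x < y × ¬ (∃[ c ] (x < c × c < y))

  ⋖-above : x < y → ∃[ c ] (x ⋖ c × c ≤ y)
  ⋖-above {x} {y} x<y = go (<-wellFounded y) x<y
    where
      go : ∀ {y} → Acc _<_ y → x < y → ∃[ c ] (x ⋖ c × c ≤ y)
      go {y} (acc rec) x<y with FinP.any? (λ c → (x <? c) ×-dec (c <? y))
      ... | no nothing-between = y , (x<y , nothing-between) , ≤-refl
      ... | yes (c , x<c , c<y) =
        let (d , x⋖d , d≤c) = go (rec c<y) x<c in d , x⋖d , ≤-trans d≤c (proj₁ c<y)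

  ⋖*⇒≤ : Star _⋖_ x y → x ≤ y
  ⋖*⇒≤ ε = ≤-refl
  ⋖*⇒≤ (x⋖y ◅ y⋖*z) = ≤-trans (proj₁ (proj₁ x⋖y)) (⋖*⇒≤ y⋖*z)

  ≤⇒⋖* : x ≤ y → Star _⋖_ x y
  ≤⇒⋖* {x} {y} x≤y = go (>-wellFounded x) x≤y
    where
      go : ∀ {x} → Acc (flip _<_) x → x ≤ y → Star _⋖_ x y
      go {x} (acc rec) x≤y with x ≟ y
      ... | yes refl = ε
      ... | no x≢y = let (c , x⋖c , c≤y) = ⋖-above (x≤y , x≢y) in x⋖c ◅ go (rec (proj₁ x⋖c)) c≤y

  NonzeroFiltersAreChains : Set
  NonzeroFiltersAreChains = ∀ {x y z} → x ≢ 𝟘 → x ≤ y → x ≤ z → y ≤ z ⊎ z ≤ y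

  ⋖-least-above : NonzeroFiltersAreChains → x ≢ 𝟘 → x ⋖ y → x < z → y ≤ z
  ⋖-least-above chains x≢𝟘 x⋖y@(x<y , _) x<z with chains x≢𝟘 (proj₁ x<y) (proj₁ x<z)
  ... | inj₁ y≤z = y≤z
  ... | inj₂ z≤y = ≤-reflexive (decidable-stable (_ ≟ _) λ y≢z → proj₂ x⋖y (_ , x<z , z≤y , y≢z ∘ sym))

  Atom : Fin n → Set
  Atom a = a ≢ 𝟘 × ¬ (∃[ y ] (y ≢ 𝟘 × y < a))

  atom-below : x ≢ 𝟘 → ∃[ a ] (Atom a × a ≤ x)
  atom-below {x} = go (<-wellFounded x)
    where
      go : ∀ {x} → Acc _<_ x → x ≢ 𝟘 → ∃[ a ] (Atom a × a ≤ x)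
      go {x} (acc rec) x≢𝟘 with FinP.any? (λ y → ¬? (y ≟ 𝟘) ×-dec (y <? x))
      ... | no nothing-below = x , (x≢𝟘 , nothing-below) , ≤-refl
      ... | yes (y , y≢𝟘 , y<x) = let (a , a-atom , a≤y) = go (rec y<x) y≢𝟘 in a , a-atom , ≤-trans a≤y (proj₁ y<x)

module _ (L : FiniteLattice) where
  open LatticeProperties L

  meetIrreducible⇒filtersAreChains : (∀ x → x ≢ 𝟘 → MeetIrreducible x) → NonzeroFiltersAreChains
  meetIrreducible⇒filtersAreChains irreducible {x} {y} {z} x≢𝟘 x≤y x≤z with y ∧ z ≟ y | y ∧ z ≟ z
  ... | yes y∧z≡y | _ = inj₁ (subst (_≤ z) y∧z≡y (x∧y≤y _ _))
  ... | no _ | yes y∧z≡z = inj₂ (subst (_≤ y) y∧z≡z (x∧y≤x _ _))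
  ... | no y∧z≢y | no y∧z≢z =
    ⊥-elim (irreducible (y ∧ z) (≢𝟘-mono x≢𝟘 (∧-greatest x≤y x≤z)) (y , z , y∧z≢y ∘ sym , y∧z≢z ∘ sym , refl))

  filtersAreChains⇒meetIrreducible : NonzeroFiltersAreChains → ∀ x → x ≢ 𝟘 → MeetIrreducible x
  filtersAreChains⇒meetIrreducible chains x x≢𝟘 (y , z , y≢x , z≢x , x≡y∧z) =
    [ proj₁ y∥z , proj₂ y∥z ] (chains x≢𝟘 (subst (_≤ y) (sym x≡y∧z) (x∧y≤x _ _)) (subst (_≤ z) (sym x≡y∧z) (x∧y≤y _ _)))
    where y∥z = ∧-incomparable x≡y∧z y≢x z≢x

  ∥⇒∧≡𝟘 : NonzeroFiltersAreChains → x ∥ y → x ∧ y ≡ 𝟘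
  ∥⇒∧≡𝟘 chains (x≰y , y≰x) =
    decidable-stable (_ ≟ 𝟘) λ x∧y≢𝟘 → [ x≰y , y≰x ] (chains x∧y≢𝟘 (x∧y≤x _ _) (x∧y≤y _ _))

  ∥⇒incomparabilityVertex : x ∥ y → Graph.Vertex (IncomparabilityGraph₀₁ L) x
  ∥⇒incomparabilityVertex x∥y = ∥⇒≢𝟘 x∥y , ∥⇒≢𝟙 x∥y

  filtersAreChains⇒zeroDivisor : JoinReducible 𝟙 → NonzeroFiltersAreChains →
                                  x ≢ 𝟘 → x ≢ 𝟙 → ∃[ w ] (w ≢ 𝟘 × x ∧ w ≡ 𝟘)
  filtersAreChains⇒zeroDivisor {x} (y₁ , z₁ , y₁≢𝟙 , z₁≢𝟙 , 𝟙≡y₁∨z₁) chains x≢𝟘 x≢𝟙 =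
    zeroDivisor (x ≤? y₁) (x ≤? z₁) (y₁ ≤? x) (z₁ ≤? x)
    where
      y₁∥z₁ : y₁ ∥ z₁
      y₁∥z₁ = ∨-incomparable 𝟙≡y₁∨z₁ y₁≢𝟙 z₁≢𝟙

      y₁∧z₁≡𝟘 : y₁ ∧ z₁ ≡ 𝟘
      y₁∧z₁≡𝟘 = ∥⇒∧≡𝟘 chains y₁∥z₁

      below-disjoint : ∀ {u v} → x ≤ u → u ∧ v ≡ 𝟘 → x ∧ v ≡ 𝟘
      below-disjoint x≤u u∧v≡𝟘 = ≤𝟘⇒≡𝟘 (subst (_ ≤_) u∧v≡𝟘 (∧-monotonic x≤u ≤-refl))

      zeroDivisor : Dec (x ≤ y₁) → Dec (x ≤ z₁) → Dec (y₁ ≤ x) → Dec (z₁ ≤ x) → ∃[ w ] (w ≢ 𝟘 × x ∧ w ≡ 𝟘)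
      zeroDivisor (yes x≤y₁) _ _ _ = z₁ , ∥⇒≢𝟘 (swap y₁∥z₁) , below-disjoint x≤y₁ y₁∧z₁≡𝟘
      zeroDivisor _ (yes x≤z₁) _ _ = y₁ , ∥⇒≢𝟘 y₁∥z₁ , below-disjoint x≤z₁ (trans (∧-comm z₁ y₁) y₁∧z₁≡𝟘)
      zeroDivisor (no x≰y₁) _ (no y₁≰x) _ = y₁ , ∥⇒≢𝟘 y₁∥z₁ , ∥⇒∧≡𝟘 chains (x≰y₁ , y₁≰x)
      zeroDivisor _ (no x≰z₁) _ (no z₁≰x) = z₁ , ∥⇒≢𝟘 (swap y₁∥z₁) , ∥⇒∧≡𝟘 chains (x≰z₁ , z₁≰x)
      zeroDivisor _ _ (yes y₁≤x) (yes z₁≤x) =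
        ⊥-elim (x≢𝟙 (antisym (maximum x) (subst (_≤ x) (sym 𝟙≡y₁∨z₁) (∨-least y₁≤x z₁≤x))))

  zeroDivisor⇒≢𝟙 : y ≢ 𝟘 → x ∧ y ≡ 𝟘 → x ≢ 𝟙
  zeroDivisor⇒≢𝟙 y≢𝟘 x∧y≡𝟘 refl = y≢𝟘 (trans (sym (y≤x⇒x∧y≈y (maximum _))) x∧y≡𝟘)

  filtersAreChains⇒zeroDivisorGraph≅incomparabilityGraph :
    JoinReducible 𝟙 → NonzeroFiltersAreChains → ZeroDivisorGraph L ≅G IncomparabilityGraph₀₁ L
  filtersAreChains⇒zeroDivisorGraph≅incomparabilityGraph 𝟙-reducible chains =
    (λ _ → mk⇔ vertex⇒ vertex⇐) , (λ _ _ → mk⇔ edge⇒ edge⇐)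
    where
      open Graph
      vertex⇒ : Vertex (ZeroDivisorGraph L) x → Vertex (IncomparabilityGraph₀₁ L) x
      vertex⇒ (x≢𝟘 , _ , w≢𝟘 , x∧w≡𝟘) = x≢𝟘 , zeroDivisor⇒≢𝟙 w≢𝟘 x∧w≡𝟘

      vertex⇐ : Vertex (IncomparabilityGraph₀₁ L) x → Vertex (ZeroDivisorGraph L) x
      vertex⇐ (x≢𝟘 , x≢𝟙) = x≢𝟘 , filtersAreChains⇒zeroDivisor 𝟙-reducible chains x≢𝟘 x≢𝟙

      edge⇒ : Edge (ZeroDivisorGraph L) x y → Edge (IncomparabilityGraph₀₁ L) x y
      edge⇒ (x-vertex , y-vertex , _ , x∧y≡𝟘) =
        vertex⇒ x-vertex , vertex⇒ y-vertex , ∧-incomparable (sym x∧y≡𝟘) (proj₁ x-vertex) (proj₁ y-vertex)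

      edge⇐ : Edge (IncomparabilityGraph₀₁ L) x y → Edge (ZeroDivisorGraph L) x y
      edge⇐ (x-vertex , y-vertex , x∥y) =
        vertex⇐ x-vertex , vertex⇐ y-vertex , (λ x≡y → proj₁ x∥y (≤-reflexive x≡y)) , ∥⇒∧≡𝟘 chains x∥y

  zeroDivisorGraph≅incomparabilityGraph⇒meetIrreducible :
    ZeroDivisorGraph L ≅G IncomparabilityGraph₀₁ L → ∀ x → x ≢ 𝟘 → MeetIrreducible x
  zeroDivisorGraph≅incomparabilityGraph⇒meetIrreducible (_ , same-edges) x x≢𝟘 (y , z , y≢x , z≢x , x≡y∧z) =
    x≢𝟘 (trans x≡y∧z (proj₂ (proj₂ (proj₂ (Equivalence.from (same-edges y z) incomparable-edge)))))
    where
      y∥z = ∧-incomparable x≡y∧z y≢x z≢x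
      incomparable-edge = ∥⇒incomparabilityVertex y∥z , ∥⇒incomparabilityVertex (swap y∥z) , y∥z

splitAt-injective : ∀ m {n} {x y : Fin (m + n)} → splitAt m x ≡ splitAt m y → x ≡ y
splitAt-injective m {n} {x} {y} eq =
  trans (sym (FinP.join-splitAt m n x)) (trans (cong (join m n) eq) (FinP.join-splitAt m n y))

AdjLeast : ∀ {m} → Adj m → Fin m → Set
AdjLeast D x = ∀ y → AdjLeq D x y

module _ {m} {D : Adj m} {a b : Fin m} {k : ℕ} where

  AdjLeast-↑ˡ : ∀ {u} → AdjLeast D u → AdjLeq D u a → AdjLeast (adj D a b k) (u ↑ˡ suc k)
  AdjLeast-↑ˡ {u} u-least u≤a w rewrite FinP.splitAt-↑ˡ m u (suc k) with splitAt m w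
  ... | inj₁ v = u-least v
  ... | inj₂ _ = u≤a

  ¬AdjLeast-↑ˡ : ∀ {x u} → ¬ AdjLeast (adj D a b k) x → splitAt m x ≡ inj₁ u → ¬ AdjLeast D u
  ¬AdjLeast-↑ˡ x-not-least x≡ u-least =
    x-not-least (subst (AdjLeast (adj D a b k)) (FinP.splitAt⁻¹-↑ˡ x≡) (AdjLeast-↑ˡ u-least (u-least a)))

mutual
  AdjLeq-antisym : ∀ {m} {D : Adj m} → LowerWF D → ∀ {x y} → AdjLeq D x y → AdjLeq D y x → x ≡ y
  AdjLeq-antisym {D = chain k} _ = FinP.≤-antisym
  AdjLeq-antisym {D = adj {m} D a b k} wf@(wfD , _ , _ , _) {x} {y}
    with splitAt m x in x≡ | splitAt m y in y≡
  ... | inj₁ u | inj₁ v = λ u≤v v≤u →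
    splitAt-injective m (trans x≡ (trans (cong inj₁ (AdjLeq-antisym wfD u≤v v≤u)) (sym y≡)))
  ... | inj₂ i | inj₂ j = λ i≤j j≤i →
    splitAt-injective m (trans x≡ (trans (cong inj₂ (FinP.≤-antisym i≤j j≤i)) (sym y≡)))
  ... | inj₁ u | inj₂ _ = λ u≤a b≤u → ⊥-elim (adjunct-gap {k = k} wf u≤a b≤u)
  ... | inj₂ _ | inj₁ v = λ b≤v v≤a → ⊥-elim (adjunct-gap {k = k} wf v≤a b≤v)

  -- Such a u is the least element a, and then b ≤ a < b.
  adjunct-gap : ∀ {m} {D : Adj m} {a b k} → LowerWF (adj D a b k) → ∀ {u} → AdjLeq D u a → AdjLeq D b u → ⊥
  adjunct-gap {D = D} (wfD , (a≤b , a≢b) , _ , a-least) {u} u≤a b≤u =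
    a≢b (AdjLeq-antisym wfD a≤b (subst (AdjLeq D _) (AdjLeq-antisym wfD u≤a (a-least u)) b≤u))

≤-least⇒least : ∀ {m} {D : Adj m} → LowerWF D → ∀ {a u} → AdjLeast D a → AdjLeq D u a → AdjLeast D u
≤-least⇒least {D = D} wf {a} {u} a-least u≤a = subst (AdjLeast D) (AdjLeq-antisym wf (a-least u) u≤a) a-least

AdjLeq-filtersAreChains : ∀ {m} {D : Adj m} → LowerWF D → ∀ {x y z} → ¬ AdjLeast D x →
                           AdjLeq D x y → AdjLeq D x z → AdjLeq D y z ⊎ AdjLeq D z y
AdjLeq-filtersAreChains {D = chain k} _ {y = y} {z} _ _ _ = FinP.≤-total y z
-- u-not-least is bound before splitting on splitAt m x, which would otherwise be abstracted out of x-not-least.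
AdjLeq-filtersAreChains {D = adj {m} D a b k} (wfD , (a≤b , a≢b) , _ , a-least) {x} {y} {z} x-not-least
  with u-not-least ← (λ {u} → ¬AdjLeast-↑ˡ {x = x} {u} x-not-least) | splitAt m x | splitAt m y | splitAt m z
... | inj₁ u | inj₁ v | inj₁ w = AdjLeq-filtersAreChains wfD (u-not-least refl)
... | inj₁ u | inj₂ _ | _ = λ u≤a _ → ⊥-elim (u-not-least refl (≤-least⇒least wfD a-least u≤a))
... | inj₁ u | inj₁ _ | inj₂ _ = λ _ u≤a → ⊥-elim (u-not-least refl (≤-least⇒least wfD a-least u≤a))
... | inj₂ _ | inj₂ j | inj₂ l = λ _ _ → FinP.≤-total j l
... | inj₂ _ | inj₂ _ | inj₁ _ = λ _ b≤w → inj₁ b≤w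
... | inj₂ _ | inj₁ _ | inj₂ _ = λ b≤v _ → inj₂ b≤v
... | inj₂ _ | inj₁ v | inj₁ w =
  AdjLeq-filtersAreChains wfD λ b-least → a≢b (AdjLeq-antisym wfD a≤b (b-least a))

module _ (L : FiniteLattice) where
  open LatticeProperties L

  lowerDismantlable⇒filtersAreChains : LowerDismantlable L → NonzeroFiltersAreChains
  lowerDismantlable⇒filtersAreChains (inj₁ isChain) _ _ _ = isChain _ _
  lowerDismantlable⇒filtersAreChains (inj₂ (D , wf , f , iso)) {x} {y} {z} x≢𝟘 x≤y x≤z =
    Sum.map (from (iso y z)) (from (iso z y))
            (AdjLeq-filtersAreChains wf not-least (to (iso x y) x≤y) (to (iso x z) x≤z))
    where
      open Equivalence
      not-least : ¬ AdjLeast D (Bijection.to f x)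
      not-least least = x≢𝟘 (≤𝟘⇒≡𝟘 (from (iso x 𝟘) (least _)))

module CoverGraph (L : FiniteLattice) where
  open LatticeProperties L
  open Graph (CoverGraph₀ L) using (Edge)

  Covers₀⇒< : Covers₀ L x y → x < y
  Covers₀⇒< (_ , _ , x<y , _) = x<y

  ⋖⇒Covers₀ : x ≢ 𝟘 → x ⋖ y → Covers₀ L x y
  ⋖⇒Covers₀ x≢𝟘 (x<y , nothing-between) =
    x≢𝟘 , ≢𝟘-mono x≢𝟘 (proj₁ x<y) , x<y , λ (c , _ , between) → nothing-between (c , between)

  ⋖*⇒walk : x ≢ 𝟘 → Star _⋖_ x y → Star Edge x y
  ⋖*⇒walk _ ε = ε
  ⋖*⇒walk x≢𝟘 (x⋖y ◅ y⋖*z) = inj₁ (⋖⇒Covers₀ x≢𝟘 x⋖y) ◅ ⋖*⇒walk (≢𝟘-mono x≢𝟘 (proj₁ (proj₁ x⋖y))) y⋖*z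

  connected : Connected (CoverGraph₀ L)
  connected x y x≢𝟘 y≢𝟘 = walk-to-𝟙 x≢𝟘 ◅◅ Star.reverse Sum.swap (walk-to-𝟙 y≢𝟘)
    where
      walk-to-𝟙 : ∀ {v} → v ≢ 𝟘 → Star Edge v 𝟙
      walk-to-𝟙 v≢𝟘 = ⋖*⇒walk v≢𝟘 (≤⇒⋖* (maximum _))

  final : Fin n → List (Fin n) → Fin n
  final x [] = x
  final _ (y ∷ ys) = final y ys

  EndsWith : Rel (Fin n) 0ℓ → Fin n → Fin n → List (Fin n) → Set
  EndsWith R x y [] = R x y
  EndsWith R _ y (z ∷ zs) = EndsWith R y z zs

  NonBacktracking : Fin n → Fin n → List (Fin n) → Set
  NonBacktracking _ _ [] = ⊤
  NonBacktracking x y (z ∷ zs) = x ≢ z × NonBacktracking y z zs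

  Up Down : Rel (Fin n) 0ℓ
  Up = Covers₀ L
  Down = flip (Covers₀ L)

  final-∷ʳ : ∀ y zs → final y (zs ++ z ∷ []) ≡ z
  final-∷ʳ y [] = refl
  final-∷ʳ y (w ∷ zs) = final-∷ʳ w zs

  final-∈ : ∀ y zs → final y zs ∈ y ∷ zs
  final-∈ y [] = here refl
  final-∈ y (z ∷ zs) = there (final-∈ z zs)

  EndsWith-∷ʳ : ∀ {R} x y zs → EndsWith R x y (zs ++ z ∷ []) → R (final y zs) z
  EndsWith-∷ʳ x y [] last = last
  EndsWith-∷ʳ x y (w ∷ zs) last = EndsWith-∷ʳ y w zs last

  lastStep : ∀ x y zs → Linked Edge (x ∷ y ∷ zs) → EndsWith Up x y zs ⊎ EndsWith Down x y zs
  lastStep x y [] (step ∷ _) = step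
  lastStep x y (z ∷ zs) (_ ∷ walk) = lastStep y z zs walk

  ¬EndsWith-Up-Down : ∀ x y zs → EndsWith Up x y zs → EndsWith Down x y zs → ⊥
  ¬EndsWith-Up-Down x y [] x⋖y y⋖x = <⇒≱ (Covers₀⇒< x⋖y) (proj₁ (Covers₀⇒< y⋖x))
  ¬EndsWith-Up-Down x y (z ∷ zs) = ¬EndsWith-Up-Down y z zs

  distinct⇒NonBacktracking : ∀ x y zs → Unique (x ∷ y ∷ zs) → All (z ≢_) (x ∷ y ∷ zs) →
                             NonBacktracking x y (zs ++ z ∷ [])
  distinct⇒NonBacktracking x y [] _ (z≢x ∷ _) = z≢x ∘ sym , tt
  distinct⇒NonBacktracking x y (w ∷ zs) ((_ ∷ x≢w ∷ _) ∷ distinct) (_ ∷ z∉) =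
    x≢w , distinct⇒NonBacktracking y w zs distinct z∉

  module _ (chains : NonzeroFiltersAreChains) where

    upperCover-unique : Covers₀ L x y → Covers₀ L x z → y ≡ z
    upperCover-unique {x} {y} {z} (x≢𝟘 , _ , x<y , y-cover) (_ , _ , x<z , z-cover)
      with chains x≢𝟘 (proj₁ x<y) (proj₁ x<z)
    ... | inj₁ y≤z = decidable-stable (y ≟ z) λ y≢z → z-cover (y , ≢𝟘-mono x≢𝟘 (proj₁ x<y) , x<y , y≤z , y≢z)
    ... | inj₂ z≤y = decidable-stable (y ≟ z) λ y≢z → y-cover (z , ≢𝟘-mono x≢𝟘 (proj₁ x<z) , x<z , z≤y , y≢z ∘ sym)

    -- Upper covers are unique, so after stepping down from x to y the only step up from y returns to x:
    -- a non-backtracking walk that steps down keeps stepping down.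
    descent : ∀ x y zs → Linked Edge (x ∷ y ∷ zs) → NonBacktracking x y zs → Down x y →
              final y zs < x × EndsWith Down x y zs
    descent x y [] _ _ y⋖x = Covers₀⇒< y⋖x , y⋖x
    descent x y (z ∷ zs) (_ ∷ inj₁ y⋖z ∷ _) (x≢z , _) y⋖x = ⊥-elim (x≢z (upperCover-unique y⋖x y⋖z))
    descent x y (z ∷ zs) (_ ∷ walk@(inj₂ z⋖y ∷ _)) (_ , nb) y⋖x =
      let (end<y , ends-down) = descent y z zs walk nb z⋖y in <-trans end<y (Covers₀⇒< y⋖x) , ends-down

    ascent : ∀ x y zs → Linked Edge (x ∷ y ∷ zs) → NonBacktracking x y zs → EndsWith Up x y zs → x < final y zs
    ascent x y [] _ _ x⋖y = Covers₀⇒< x⋖y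
    ascent x y (z ∷ zs) (inj₁ x⋖y ∷ walk) (_ , nb) ends-up = <-trans (Covers₀⇒< x⋖y) (ascent y z zs walk nb ends-up)
    ascent x y (z ∷ zs) walk@(inj₂ y⋖x ∷ _) nb ends-up =
      ⊥-elim (¬EndsWith-Up-Down y z zs ends-up (proj₂ (descent x y (z ∷ zs) walk nb y⋖x)))

    acyclic : ¬ HasCycle (CoverGraph₀ L)
    acyclic (v₀ , v₁ , v₂ , rest , _ , v₀∉ ∷ tail-distinct@(v₁∉ ∷ _) , walk) = closed (lastStep v₀ v₁ zs walk) walk
      where
        zs = v₂ ∷ rest ++ v₀ ∷ []

        final≡v₀ : final v₁ zs ≡ v₀
        final≡v₀ = final-∷ʳ v₁ (v₂ ∷ rest)

        nb : NonBacktracking v₀ v₁ zs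
        nb = All.lookup v₀∉ (there (here refl)) , distinct⇒NonBacktracking v₁ v₂ rest tail-distinct v₀∉

        closed : EndsWith Up v₀ v₁ zs ⊎ EndsWith Down v₀ v₁ zs → Linked Edge (v₀ ∷ v₁ ∷ zs) → ⊥
        closed _ walk@(inj₂ v₁⋖v₀ ∷ _) = <-irrefl (subst (_< v₀) final≡v₀ (proj₁ (descent v₀ v₁ zs walk nb v₁⋖v₀)))
        closed (inj₁ ends-up) walk@(inj₁ _ ∷ _) = <-irrefl (subst (v₀ <_) final≡v₀ (ascent v₀ v₁ zs walk nb ends-up))
        closed (inj₂ ends-down) (inj₁ v₀⋖v₁ ∷ _) =
          All.lookup v₁∉ (final-∈ v₂ rest) (upperCover-unique v₀⋖v₁ (EndsWith-∷ʳ v₀ v₁ (v₂ ∷ rest) ends-down))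

  ascending : Star _⋖_ x y → List (Fin n)
  ascending ε = []
  ascending (_◅_ {j = c} _ cs) = c ∷ ascending cs

  descending-onto : Star _⋖_ x y → List (Fin n) → List (Fin n)
  descending-onto ε rest = rest
  descending-onto {x} (_ ◅ cs) rest = descending-onto cs (x ∷ rest)

  descending-onto-++ : ∀ (cs : Star _⋖_ x y) rest ws → descending-onto cs rest ++ ws ≡ descending-onto cs (rest ++ ws)
  descending-onto-++ ε rest ws = refl
  descending-onto-++ {x} (_ ◅ cs) rest ws = descending-onto-++ cs (x ∷ rest) ws

  ascending-between : (cs : Star _⋖_ x y) → All (λ e → x < e × e ≤ y) (ascending cs)
  ascending-between ε = []
  ascending-between (x⋖c ◅ cs) =
    (proj₁ x⋖c , ⋖*⇒≤ cs) ∷ All.map (λ (c<e , e≤y) → <-trans (proj₁ x⋖c) c<e , e≤y) (ascending-between cs)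

  descending-onto-between : ∀ {P : Fin n → Set} (cs : Star _⋖_ x y) {rest} →
                            (∀ {e} → x ≤ e → e < y → P e) → All P rest → All P (descending-onto cs rest)
  descending-onto-between ε _ all-rest = all-rest
  descending-onto-between (x⋖c ◅ cs) P-between all-rest =
    descending-onto-between cs (λ c≤e → P-between (≤-trans (proj₁ (proj₁ x⋖c)) c≤e))
      (P-between ≤-refl (<-≤-trans (proj₁ x⋖c) (⋖*⇒≤ cs)) ∷ all-rest)

  ascending-unique : (cs : Star _⋖_ x y) → Unique (x ∷ ascending cs)
  ascending-unique cs = All.map (λ x<e → proj₂ (proj₁ x<e)) (ascending-between cs) ∷ tail cs
    where
      tail : (cs : Star _⋖_ x y) → Unique (ascending cs)
      tail ε = []
      tail (_ ◅ cs) = ascending-unique cs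

  descending-onto-unique : (cs : Star _⋖_ x y) {rest : List (Fin n)} →
                           Unique rest → All (_< x) rest → Unique (descending-onto cs rest)
  descending-onto-unique ε distinct _ = distinct
  descending-onto-unique {x} (x⋖c ◅ cs) distinct rest<x =
    descending-onto-unique cs (All.map (λ e<x x≡e → <-irrefl (subst (_< x) (sym x≡e) e<x)) rest<x ∷ distinct)
      (proj₁ x⋖c ∷ All.map (λ e<x → <-trans e<x (proj₁ x⋖c)) rest<x)

  ascending-walk : x ≢ 𝟘 → (cs : Star _⋖_ x y) → ∀ {ws} → Linked Edge (y ∷ ws) → Linked Edge (x ∷ ascending cs ++ ws)
  ascending-walk _ ε walk = walk
  ascending-walk x≢𝟘 (x⋖c ◅ cs) walk =
    inj₁ (⋖⇒Covers₀ x≢𝟘 x⋖c) ∷ ascending-walk (≢𝟘-mono x≢𝟘 (proj₁ (proj₁ x⋖c))) cs walk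

  descending-walk : x ≢ 𝟘 → (cs : Star _⋖_ x y) → ∀ {rest} →
                    Linked Edge (x ∷ rest) → Linked Edge (y ∷ descending-onto cs rest)
  descending-walk _ ε walk = walk
  descending-walk x≢𝟘 (x⋖c ◅ cs) walk =
    descending-walk (≢𝟘-mono x≢𝟘 (proj₁ (proj₁ x⋖c))) cs (inj₂ (⋖⇒Covers₀ x≢𝟘 x⋖c) ∷ walk)

  -- x, then up a saturated chain from u₁ to w, then down one to u₂, and back to x.
  cover-cycle : ∀ {x u₁ u₂ w} → x ≢ 𝟘 → x ⋖ u₁ → x ⋖ u₂ → (∀ {v} → u₁ ≤ v → u₂ ≤ v → w ≤ v) →
                Star _⋖_ u₁ w → Star _⋖_ u₂ w → u₁ ≢ w → HasCycle (CoverGraph₀ L)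
  cover-cycle _ _ _ _ ε _ u₁≢w = ⊥-elim (u₁≢w refl)
  cover-cycle {x} {u₁} {u₂} {w} x≢𝟘 x⋖u₁ x⋖u₂ w-least up@(_◅_ {j = c} _ up′) down _ =
    x , u₁ , c , rest , nonzero , x∉ ∷ UniqueP.++⁺ (ascending-unique up) (descending-onto-unique down [] []) disjoint ,
    closed-walk
    where
      rest = ascending up′ ++ descending-onto down []

      above-u₁ : All (u₁ ≤_) (u₁ ∷ ascending up)
      above-u₁ = ≤-refl ∷ All.map (proj₁ ∘ proj₁) (ascending-between up)

      above-u₂-below-w : All (λ e → u₂ ≤ e × e < w) (descending-onto down [])
      above-u₂-below-w = descending-onto-between down _,_ []

      above-x : All (x <_) (u₁ ∷ c ∷ rest)
      above-x = AllP.++⁺ (All.map (<-≤-trans (proj₁ x⋖u₁)) above-u₁)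
                         (All.map (<-≤-trans (proj₁ x⋖u₂) ∘ proj₁) above-u₂-below-w)

      nonzero : ∀ v → v ∈ x ∷ u₁ ∷ c ∷ rest → v ≢ 𝟘
      nonzero _ (here refl) = x≢𝟘
      nonzero _ (there v∈) = ≢𝟘-mono x≢𝟘 (proj₁ (All.lookup above-x v∈))

      x∉ : All (x ≢_) (u₁ ∷ c ∷ rest)
      x∉ = All.map proj₂ above-x

      disjoint : Disjoint (u₁ ∷ ascending up) (descending-onto down [])
      disjoint (v∈up , v∈down) =
        let (u₂≤v , v<w) = All.lookup above-u₂-below-w v∈down
        in <⇒≱ v<w (w-least (All.lookup above-u₁ v∈up) u₂≤v)

      closed-walk : Linked Edge ((x ∷ u₁ ∷ c ∷ rest) ++ x ∷ [])
      closed-walk = subst (λ ws → Linked Edge (x ∷ u₁ ∷ c ∷ ws)) rearranged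
        (inj₁ (⋖⇒Covers₀ x≢𝟘 x⋖u₁) ∷
         ascending-walk (cover≢𝟘 x⋖u₁) up (descending-walk (cover≢𝟘 x⋖u₂) down (inj₂ (⋖⇒Covers₀ x≢𝟘 x⋖u₂) ∷ [-])))
        where
          cover≢𝟘 : ∀ {u} → x ⋖ u → u ≢ 𝟘
          cover≢𝟘 x⋖u = ≢𝟘-mono x≢𝟘 (proj₁ (proj₁ x⋖u))
          rearranged : ascending up′ ++ descending-onto down (x ∷ []) ≡ rest ++ x ∷ []
          rearranged = trans (cong (ascending up′ ++_) (sym (descending-onto-++ down [] (x ∷ []))))
                             (sym (++-assoc (ascending up′) (descending-onto down []) (x ∷ [])))

  filtersAreChains⇒coverGraphIsTree : NonzeroFiltersAreChains → IsTree (CoverGraph₀ L)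
  filtersAreChains⇒coverGraphIsTree chains = connected , acyclic chains

  coverGraphIsTree⇒meetIrreducible : IsTree (CoverGraph₀ L) → ∀ x → x ≢ 𝟘 → MeetIrreducible x
  coverGraphIsTree⇒meetIrreducible (_ , no-cycle) x x≢𝟘 (y , z , y≢x , z≢x , x≡y∧z) =
    no-cycle (cover-cycle x≢𝟘 x⋖u₁ x⋖u₂ ∨-least (≤⇒⋖* (x≤x∨y _ _)) (≤⇒⋖* (y≤x∨y _ _)) u₁≢u₁∨u₂)
    where
      cover₁ = ⋖-above (subst (_≤ y) (sym x≡y∧z) (x∧y≤x _ _) , y≢x ∘ sym)
      cover₂ = ⋖-above (subst (_≤ z) (sym x≡y∧z) (x∧y≤y _ _) , z≢x ∘ sym)
      u₁ = proj₁ cover₁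
      u₂ = proj₁ cover₂
      x⋖u₁ = proj₁ (proj₂ cover₁)
      x⋖u₂ = proj₁ (proj₂ cover₂)

      -- u₂ ≤ u₁ would force u₂ = u₁ (u₁ covers x), but then u₁ ≤ y ∧ z = x.
      u₁≢u₁∨u₂ : u₁ ≢ u₁ ∨ u₂
      u₁≢u₁∨u₂ u₁≡u₁∨u₂ with u₂ ≟ u₁
      ... | yes u₂≡u₁ = <⇒≱ (proj₁ x⋖u₁) (subst (u₁ ≤_) (sym x≡y∧z)
                         (∧-greatest (proj₂ (proj₂ cover₁)) (subst (_≤ z) u₂≡u₁ (proj₂ (proj₂ cover₂)))))
      ... | no u₂≢u₁ = proj₂ x⋖u₁ (u₂ , proj₁ x⋖u₂ , subst (u₂ ≤_) (sym u₁≡u₁∨u₂) (y≤x∨y _ _) , u₂≢u₁)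

module Construction (L : FiniteLattice) (chains : LatticeProperties.NonzeroFiltersAreChains L) where
  open LatticeProperties L

  record IntervalChain (l x : Fin n) : Set where
    field
      k : ℕ
      at : Fin (suc k) → Fin n
      at-mono : ∀ {i j} → i F.≤ j → at i ≤ at j
      at-reflect : ∀ {i j} → at i ≤ at j → i F.≤ j
      at-zero : at zero ≡ l
      at-≤ : ∀ i → at i ≤ x
      at-onto : ∀ {s} → l ≤ s → s ≤ x → ∃[ i ] (at i ≡ s)

    at-≥ : ∀ i → l ≤ at i
    at-≥ i = subst (_≤ at i) at-zero (at-mono z≤n)

    at≢𝟘 : l ≢ 𝟘 → ∀ i → at i ≢ 𝟘
    at≢𝟘 l≢𝟘 i = ≢𝟘-mono l≢𝟘 (at-≥ i)

  interval-chain : ∀ {l x} → l ≢ 𝟘 → Star _⋖_ l x → IntervalChain l x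
  interval-chain {l} _ ε = record
    { k = 0 ; at = λ _ → l ; at-mono = λ _ → ≤-refl ; at-reflect = λ { {zero} {zero} _ → z≤n }
    ; at-zero = refl ; at-≤ = λ _ → ≤-refl ; at-onto = λ l≤s s≤l → zero , antisym l≤s s≤l }
  interval-chain {l} {x} l≢𝟘 (l⋖c ◅ cs) = record
    { k = suc k ; at = at′ ; at-mono = at′-mono ; at-reflect = at′-reflect ; at-zero = refl
    ; at-≤ = at′-≤ ; at-onto = at′-onto }
    where
      open IntervalChain (interval-chain (≢𝟘-mono l≢𝟘 (proj₁ (proj₁ l⋖c))) cs)

      at′ : Fin (suc (suc k)) → Fin n
      at′ zero = l
      at′ (suc i) = at i

      l<at : ∀ i → l < at i
      l<at i = <-≤-trans (proj₁ l⋖c) (at-≥ i)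

      at′-mono : ∀ {i j} → i F.≤ j → at′ i ≤ at′ j
      at′-mono {zero} {zero} _ = ≤-refl
      at′-mono {zero} {suc j} _ = proj₁ (l<at j)
      at′-mono {suc i} {suc j} (s≤s i≤j) = at-mono i≤j

      at′-reflect : ∀ {i j} → at′ i ≤ at′ j → i F.≤ j
      at′-reflect {zero} _ = z≤n
      at′-reflect {suc i} {zero} at-i≤l = ⊥-elim (<⇒≱ (l<at i) at-i≤l)
      at′-reflect {suc i} {suc j} at-i≤at-j = s≤s (at-reflect at-i≤at-j)

      at′-≤ : ∀ i → at′ i ≤ x
      at′-≤ zero = ⋖*⇒≤ (l⋖c ◅ cs)
      at′-≤ (suc i) = at-≤ i

      at′-onto : ∀ {s} → l ≤ s → s ≤ x → ∃[ i ] (at′ i ≡ s)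
      at′-onto {s} l≤s s≤x with l ≟ s
      ... | yes l≡s = zero , l≡s
      ... | no l≢s =
        let (i , at-i≡s) = at-onto (⋖-least-above chains l≢𝟘 l⋖c (l≤s , l≢s)) s≤x
        in suc i , at-i≡s

  -- An adjunct of chains order-embedded in L, to be extended until the embedding is onto.
  record Approximation (m : ℕ) : Set where
    field
      D : Adj m
      lowerWF : LowerWF D
      embed : Fin m → Fin n
      embed-mono : ∀ {u v} → AdjLeq D u v → embed u ≤ embed v
      embed-reflect : ∀ {u v} → embed u ≤ embed v → AdjLeq D u v
      bottom : Fin m
      embed-bottom : embed bottom ≡ 𝟘
      top : Fin m
      embed-top : embed top ≡ 𝟙

    Image : Fin n → Set
    Image s = ∃[ u ] (embed u ≡ s)

    field
      up-closed : ∀ {u s} → embed u ≢ 𝟘 → embed u ≤ s → Image s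
      atom-under : ∀ {u} → embed u ≢ 𝟘 → ∃[ v ] (Atom (embed v) × embed v ≤ embed u)

    Image? : Decidable₁ Image
    Image? s = FinP.any? λ u → embed u ≟ s

    embed-injective : Injective _≡_ _≡_ embed
    embed-injective e = AdjLeq-antisym lowerWF (embed-reflect (≤-reflexive e)) (embed-reflect (≤-reflexive (sym e)))

    bottom-least : AdjLeast D bottom
    bottom-least u = embed-reflect (subst (_≤ embed u) (sym embed-bottom) (minimum _))

    size≤n : m ℕ.≤ n
    size≤n = FinP.injective⇒≤ embed-injective

  initial : ∀ {l} → Atom l → (C : IntervalChain l 𝟙) → Approximation (suc (suc (IntervalChain.k C)))
  initial {l} l-atom@(l≢𝟘 , _) C = record
    { D = chain (suc k) ; lowerWF = tt ; embed = embed ; embed-mono = embed-mono ; embed-reflect = embed-reflect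
    ; bottom = zero ; embed-bottom = refl ; top = suc (proj₁ top) ; embed-top = proj₂ top
    ; up-closed = λ {u} → up-closed {u} ; atom-under = λ {u} → atom-under {u} }
    where
      open IntervalChain C

      embed : Fin (suc (suc k)) → Fin n
      embed zero = 𝟘
      embed (suc i) = at i

      embed-mono : ∀ {u v} → u F.≤ v → embed u ≤ embed v
      embed-mono {zero} _ = minimum _
      embed-mono {suc _} {suc _} (s≤s i≤j) = at-mono i≤j

      embed-reflect : ∀ {u v} → embed u ≤ embed v → u F.≤ v
      embed-reflect {zero} _ = z≤n
      embed-reflect {suc i} {zero} at-i≤𝟘 = ⊥-elim (at≢𝟘 l≢𝟘 i (≤𝟘⇒≡𝟘 at-i≤𝟘))
      embed-reflect {suc _} {suc _} at-i≤at-j = s≤s (at-reflect at-i≤at-j)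

      top = at-onto (maximum l) ≤-refl

      up-closed : ∀ {u s} → embed u ≢ 𝟘 → embed u ≤ s → ∃[ v ] (embed v ≡ s)
      up-closed {zero} 𝟘≢𝟘 = ⊥-elim (𝟘≢𝟘 refl)
      up-closed {suc i} _ at-i≤s = let (j , at-j≡s) = at-onto (≤-trans (at-≥ i) at-i≤s) (maximum _) in suc j , at-j≡s

      atom-under : ∀ {u} → embed u ≢ 𝟘 → ∃[ v ] (Atom (embed v) × embed v ≤ embed u)
      atom-under {zero} 𝟘≢𝟘 = ⊥-elim (𝟘≢𝟘 refl)
      atom-under {suc i} _ = suc zero , subst Atom (sym at-zero) l-atom , at-mono z≤n

  module Extension {m} (A : Approximation m) {x : Fin n} (x∉ : ¬ Approximation.Image A x)
                   (pᵢ : Fin m) (x⋖p : x ⋖ Approximation.embed A pᵢ)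
                   {l : Fin n} (l-atom : Atom l) (C : IntervalChain l x) where
    open Approximation A
    open IntervalChain C

    x≢𝟘 : x ≢ 𝟘
    x≢𝟘 refl = x∉ (bottom , embed-bottom)

    p≢𝟘 : embed pᵢ ≢ 𝟘
    p≢𝟘 = ≢𝟘-mono x≢𝟘 (proj₁ (proj₁ x⋖p))

    at∉ : ∀ i → ¬ Image (at i)
    at∉ i (u , u≡at) =
      x∉ (up-closed (subst (_≢ 𝟘) (sym u≡at) (at≢𝟘 (proj₁ l-atom) i)) (subst (_≤ x) (sym u≡at) (at-≤ i)))

    below-at⇒𝟘 : ∀ {u j} → embed u ≤ at j → embed u ≡ 𝟘
    below-at⇒𝟘 {j = j} u≤at = decidable-stable (_ ≟ 𝟘) λ u≢𝟘 → at∉ j (up-closed u≢𝟘 u≤at)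

    above-at-comparable-to-x : ∀ {i s} → at i ≤ s → x < s ⊎ s ≤ x
    above-at-comparable-to-x {i} {s} at≤s with chains (at≢𝟘 (proj₁ l-atom) i) (at-≤ i) at≤s | x ≟ s
    ... | inj₂ s≤x | _ = inj₂ s≤x
    ... | inj₁ _ | yes refl = inj₂ ≤-refl
    ... | inj₁ x≤s | no x≢s = inj₁ (x≤s , x≢s)

    D′ : Adj (m + suc k)
    D′ = adj D bottom pᵢ k

    embed′ : Fin (m + suc k) → Fin n
    embed′ w = [ embed , at ]′ (splitAt m w)

    embed′-↑ˡ : ∀ u → embed′ (u ↑ˡ suc k) ≡ embed u
    embed′-↑ˡ u rewrite FinP.splitAt-↑ˡ m u (suc k) = refl

    embed′-↑ʳ : ∀ i → embed′ (m ↑ʳ i) ≡ at i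
    embed′-↑ʳ i rewrite FinP.splitAt-↑ʳ m (suc k) i = refl

    Image′ : Fin n → Set
    Image′ s = ∃[ w ] (embed′ w ≡ s)

    old : ∀ {s} → Image s → Image′ s
    old (u , embed-u≡s) = u ↑ˡ suc k , trans (embed′-↑ˡ u) embed-u≡s

    new : ∀ {s} → ∃[ i ] (at i ≡ s) → Image′ s
    new (i , at-i≡s) = m ↑ʳ i , trans (embed′-↑ʳ i) at-i≡s

    lowerWF′ : LowerWF D′
    lowerWF′ = lowerWF , (bottom-least pᵢ , bottom≢p) , not-covering , bottom-least
      where
        bottom≢p : bottom ≢ pᵢ
        bottom≢p refl = p≢𝟘 embed-bottom

        -- An atom of the image below p lies strictly between bottom and p, because x < p.
        not-covering : ¬ AdjCovers D bottom pᵢ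
        not-covering (_ , nothing-between) =
          let (a , (a≢𝟘 , a-minimal) , a≤p) = atom-under p≢𝟘
              bottom≢a = λ b≡a → a≢𝟘 (subst (λ v → embed v ≡ 𝟘) b≡a embed-bottom)
              a≢p = λ a≡p → a-minimal (x , x≢𝟘 , subst (λ v → x < embed v) (sym a≡p) (proj₁ x⋖p))
          in nothing-between (a , (bottom-least a , bottom≢a) , (embed-reflect a≤p , a≢p))

    embed′-mono : ∀ w₁ w₂ → AdjLeq D′ w₁ w₂ → embed′ w₁ ≤ embed′ w₂
    embed′-mono w₁ w₂ with splitAt m w₁ | splitAt m w₂
    ... | inj₁ _ | inj₁ _ = embed-mono
    ... | inj₂ _ | inj₂ _ = at-mono
    ... | inj₁ u | inj₂ _ = λ u≤bottom → ≤-trans (subst (embed u ≤_) embed-bottom (embed-mono u≤bottom)) (minimum _)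
    ... | inj₂ i | inj₁ _ = λ p≤v → ≤-trans (at-≤ i) (≤-trans (proj₁ (proj₁ x⋖p)) (embed-mono p≤v))

    embed′-reflect : ∀ w₁ w₂ → embed′ w₁ ≤ embed′ w₂ → AdjLeq D′ w₁ w₂
    embed′-reflect w₁ w₂ with splitAt m w₁ | splitAt m w₂
    ... | inj₁ _ | inj₁ _ = embed-reflect
    ... | inj₂ _ | inj₂ _ = at-reflect
    ... | inj₁ _ | inj₂ _ = λ u≤at → embed-reflect (≤-reflexive (trans (below-at⇒𝟘 u≤at) (sym embed-bottom)))
    ... | inj₂ _ | inj₁ v = λ at≤v → embed-reflect ([ p≤v , (λ v≤x → ⊥-elim (x∉ (up-closed (v≢𝟘 at≤v) v≤x))) ]
                                                     (above-at-comparable-to-x at≤v))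
      where
        v≢𝟘 : ∀ {i} → at i ≤ embed v → embed v ≢ 𝟘
        v≢𝟘 {i} = ≢𝟘-mono (at≢𝟘 (proj₁ l-atom) i)
        p≤v : x < embed v → embed pᵢ ≤ embed v
        p≤v = ⋖-least-above chains x≢𝟘 x⋖p

    up-closed′ : ∀ w {s} → embed′ w ≢ 𝟘 → embed′ w ≤ s → Image′ s
    up-closed′ w with splitAt m w
    ... | inj₁ _ = λ u≢𝟘 u≤s → old (up-closed u≢𝟘 u≤s)
    ... | inj₂ j = λ _ at≤s → [ (λ x<s → old (up-closed p≢𝟘 (⋖-least-above chains x≢𝟘 x⋖p x<s))) ,
                                (λ s≤x → new (at-onto (≤-trans (at-≥ j) at≤s) s≤x)) ] (above-at-comparable-to-x at≤s)

    atom-under′ : ∀ w → embed′ w ≢ 𝟘 → ∃[ v ] (Atom (embed′ v) × embed′ v ≤ embed′ w)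
    atom-under′ w with splitAt m w
    ... | inj₁ _ = λ u≢𝟘 → let (v , v-atom , v≤u) = atom-under u≢𝟘 in
                           v ↑ˡ suc k , subst Atom (sym (embed′-↑ˡ v)) v-atom , subst (_≤ _) (sym (embed′-↑ˡ v)) v≤u
    ... | inj₂ j = λ _ → m ↑ʳ zero , subst Atom (sym (trans (embed′-↑ʳ zero) at-zero)) l-atom ,
                         subst (_≤ at j) (sym (embed′-↑ʳ zero)) (at-mono z≤n)

    extended : Approximation (m + suc k)
    extended = record
      { D = D′ ; lowerWF = lowerWF′ ; embed = embed′
      ; embed-mono = λ {w₁} {w₂} → embed′-mono w₁ w₂ ; embed-reflect = λ {w₁} {w₂} → embed′-reflect w₁ w₂
      ; bottom = bottom ↑ˡ suc k ; embed-bottom = trans (embed′-↑ˡ bottom) embed-bottom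
      ; top = top ↑ˡ suc k ; embed-top = trans (embed′-↑ˡ top) embed-top
      ; up-closed = λ {w} → up-closed′ w ; atom-under = λ {w} → atom-under′ w }

  module _ {m} (A : Approximation m) where
    open Approximation A

    unrepresented-⋖-image : ∀ {s} → ¬ Image s → ∃[ x ] ∃[ pᵢ ] (¬ Image x × x ⋖ embed pᵢ)
    unrepresented-⋖-image {s} = go (>-wellFounded s)
      where
        go : ∀ {s} → Acc (flip _<_) s → ¬ Image s → ∃[ x ] ∃[ pᵢ ] (¬ Image x × x ⋖ embed pᵢ)
        go {s} (acc rec) s∉ with ⋖-above (maximum s , λ s≡𝟙 → s∉ (top , trans embed-top (sym s≡𝟙)))
        ... | p , s⋖p , _ with Image? p
        ...   | yes (pᵢ , refl) = s , pᵢ , s∉ , s⋖p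
        ...   | no p∉ = go (rec (proj₁ s⋖p)) p∉

    extend : ∀ {s} → ¬ Image s → ∃[ m′ ] (m ℕ.< m′ × Approximation m′)
    extend s∉ =
      let (x , pᵢ , x∉ , x⋖p) = unrepresented-⋖-image s∉
          (l , l-atom , l≤x) = atom-below λ x≡𝟘 → x∉ (bottom , trans embed-bottom (sym x≡𝟘))
      in _ , ℕ.m<m+n m ℕ.z<s , Extension.extended A x∉ pᵢ x⋖p l-atom (interval-chain (proj₁ l-atom) (≤⇒⋖* l≤x))

  Complete : Set
  Complete = ∃[ m ] Σ (Approximation m) λ A → ∀ s → Approximation.Image A s

  saturate : ∀ {m} → Approximation m → Acc ℕ._<_ (n ∸ m) → Complete
  saturate A (acc rec) with FinP.all? (Approximation.Image? A)
  ... | yes onto = _ , A , onto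
  ... | no not-onto =
    let (_ , s∉) = FinP.¬∀⟶∃¬ n _ (Approximation.Image? A) not-onto
        (_ , m<m′ , A′) = extend A s∉
    in saturate A′ (rec (ℕ.∸-monoʳ-< m<m′ (Approximation.size≤n A′)))

  module Onto {m} (A : Approximation m) (onto : ∀ s → Approximation.Image A s) where
    open Approximation A

    index : Fin n → Fin m
    index s = proj₁ (onto s)

    embed-index : ∀ s → embed (index s) ≡ s
    embed-index s = proj₂ (onto s)

    index-injective : Injective _≡_ _≡_ index
    index-injective {s} {t} eq = trans (sym (embed-index s)) (trans (cong embed eq) (embed-index t))

    m≡n : m ≡ n
    m≡n = ℕ.≤-antisym size≤n (FinP.injective⇒≤ index-injective)

  onto⇒lowerDismantlable : (A : Approximation n) → (∀ s → Approximation.Image A s) → LowerDismantlable L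
  onto⇒lowerDismantlable A onto =
    inj₂ (D , lowerWF , ↔⇒⤖ (mk↔ₛ′ index embed (λ u → embed-injective (embed-index (embed u))) embed-index) ,
          λ x y → mk⇔ (embed-reflect ∘ subst₂ _≤_ (sym (embed-index x)) (sym (embed-index y)))
                      (subst₂ _≤_ (embed-index x) (embed-index y) ∘ embed-mono))
    where
      open Approximation A
      open Onto A onto

  complete⇒lowerDismantlable : Complete → LowerDismantlable L
  complete⇒lowerDismantlable (_ , A , onto) with Onto.m≡n A onto
  ... | refl = onto⇒lowerDismantlable A onto

  lowerDismantlable : LowerDismantlable L
  lowerDismantlable with 𝟙 ≟ 𝟘
  ... | yes 𝟙≡𝟘 = inj₁ λ x y → inj₁ (≤-trans (maximum x) (subst (_≤ y) (sym 𝟙≡𝟘) (minimum y)))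
  ... | no 𝟙≢𝟘 =
    let (l , l-atom , _) = atom-below 𝟙≢𝟘
        C = interval-chain (proj₁ l-atom) (≤⇒⋖* (maximum l))
    in complete⇒lowerDismantlable (saturate (initial l-atom C) (ℕ.<-wellFounded _))

open FiniteLattice

theorem2p13 : (L : FiniteLattice) → JoinReducible L (𝟙 L) →
    (LowerDismantlable L ⇔ (∀ x → x ≢ 𝟘 L → MeetIrreducible L x))
    × (LowerDismantlable L ⇔ IsTree (CoverGraph₀ L))
    × (LowerDismantlable L ⇔ (ZeroDivisorGraph L ≅G IncomparabilityGraph₀₁ L))
theorem2p13 L 𝟙-reducible =
  mk⇔ (filtersAreChains⇒meetIrreducible L ∘ toChains) fromIrreducible ,
  mk⇔ (filtersAreChains⇒coverGraphIsTree ∘ toChains) (fromIrreducible ∘ coverGraphIsTree⇒meetIrreducible) ,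
  mk⇔ (filtersAreChains⇒zeroDivisorGraph≅incomparabilityGraph L 𝟙-reducible ∘ toChains)
      (fromIrreducible ∘ zeroDivisorGraph≅incomparabilityGraph⇒meetIrreducible L)
  where
    open CoverGraph L using (filtersAreChains⇒coverGraphIsTree; coverGraphIsTree⇒meetIrreducible)

    toChains : LowerDismantlable L → LatticeProperties.NonzeroFiltersAreChains L
    toChains = lowerDismantlable⇒filtersAreChains L

    fromIrreducible : (∀ x → x ≢ 𝟘 L → MeetIrreducible L x) → LowerDismantlable L
    fromIrreducible = Construction.lowerDismantlable L ∘ meetIrreducible⇒filtersAreChains L
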